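{- Let $k \ge 1$ and let $R(2k)$ denote the diagonal Ramsey number (the least $N$ such that every graph on $N$ vertices contains a clique or an independent set of size $2k$). Then every graph $G$ on $n \ge R(2k)$ vertices has an induced subgraph $H$ with $2k$ vertices such that, for every permutation $\pi$ of $\{1,\dots,k\}$, $H$ is a $k$-letter graph on the word \[ w = \ell_1 \, \ell_2 \cdots \ell_k \, \ell_{\pi(1)} \, \ell_{\pi(2)} \cdots \ell_{\pi(k)}, \] i.e., $H \cong \Gamma_D(w)$ for some decoder $D \subseteq \{\ell_1,\dots,\ell_k\}^2$. Consequently $\ell(G) \le n-k$.
   Context: For a finite alphabet $\Sigma$, a decoder is a set $D \subseteq \Sigma^2$ of ordered pairs. For a word $w = w(1)w(2)\cdots w(n)$ with letters in $\Sigma$, the letter graph $\Gamma_D(w)$ is the graph with vertex set $\{1,\dots,n\}$ and an edge between $i<j$ exactly when $(w(i),w(j)) \in D$. If $|\Sigma| = k$, $\Gamma_D(w)$ is called a $k$-letter graph. The lettericity $\ell(G)$ of a graph $G$ is the least integer $k$ such that $G$ is isomorphic to a $k$-letter graph. -}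

module Defs where

open import Data.Nat using (ℕ; _≤_; _+_)
open import Data.Fin using (Fin; _<?_; splitAt)
open import Data.Bool using (Bool; true; false; if_then_else_)
open import Data.Sum using (_⊎_; [_,_]′)
open import Data.Product using (Σ; ∃; _×_)
open import Function using (id)
open import Function.Definitions using (Injective)
open import Function.Bundles using (Inverse)
open import Data.Fin.Permutation using (Permutation′; _⟨$⟩ʳ_)
open import Relation.Binary.PropositionalEquality using (_≡_; _≢_)
open import Relation.Nullary.Decidable using (⌊_⌋)

record Graph (n : ℕ) : Set where
  field
    adj   : Fin n → Fin n → Bool
    sym   : ∀ u v → adj u v ≡ adj v u
    irrefl : ∀ u → adj u u ≡ false
open Graph public

Adj : ℕ → Set
Adj n = Fin n → Fin n → Bool

Iso : ∀ {n} → Adj n → Adj n → Set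
Iso {n} A B = Σ (Permutation′ n) λ σ → ∀ u v → A u v ≡ B (σ ⟨$⟩ʳ u) (σ ⟨$⟩ʳ v)

-- The letter graph Γ_D(w): word w of length n over alphabet Fin k, decoder D ⊆ (Fin k)²
-- (as a Bool-valued characteristic function); i<j adjacent iff (w i , w j) ∈ D.
letterGraph : ∀ {n k} → (Fin k → Fin k → Bool) → (Fin n → Fin k) → Adj n
letterGraph D w i j =
  if ⌊ i <? j ⌋ then D (w i) (w j)
  else (if ⌊ j <? i ⌋ then D (w j) (w i) else false)

IsLetterGraph : ∀ {n} → Graph n → ℕ → Set
IsLetterGraph {n} G k =
  Σ (Fin n → Fin k) λ w → Σ (Fin k → Fin k → Bool) λ D → Iso (adj G) (letterGraph D w)

-- ℓ(G) ≤ m  (the least such k is ≤ m iff some k ≤ m works).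
LettericityAtMost : ∀ {n} → Graph n → ℕ → Set
LettericityAtMost G m = ∃ λ k → k ≤ m × IsLetterGraph G k

induced : ∀ {n m} → Graph n → (Fin m → Fin n) → Adj m
induced G f i j = adj G (f i) (f j)

HasHomogeneous : ∀ {N} → Graph N → ℕ → Set
HasHomogeneous {N} G m =
  Σ (Fin m → Fin N) λ f → Injective _≡_ _≡_ f ×
    ((∀ i j → i ≢ j → adj G (f i) (f j) ≡ true) ⊎ (∀ i j → adj G (f i) (f j) ≡ false))

RamseyProp : ℕ → ℕ → Set
RamseyProp m N = (G : Graph N) → HasHomogeneous G m

IsRamseyNumber : ℕ → ℕ → Set
IsRamseyNumber m R = RamseyProp m R × (∀ N → RamseyProp m N → R ≤ N)

permWord : ∀ {k} → Permutation′ k → Fin (k + k) → Fin k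
permWord {k} π i = [ id , (π ⟨$⟩ʳ_) ]′ (splitAt k i)

-- A homogeneous set on 2k vertices exists by Ramsey's theorem, and a clique or
-- an independent set is a letter graph on any word, with a constant decoder. For
-- the lettericity bound, relabel G so that the homogeneous set occupies the first
-- k and the last k positions, let the i-th vertex of the back block reuse the
-- letter of the i-th vertex of the front block, and give every other vertex its
-- own letter. Each other vertex lies between the two vertices sharing a letter, so
-- it sees them through different decoder entries; an entry between two shared
-- letters is read only on pairs of the homogeneous set, which all agree.
module Submission where

open import Defs
open import Data.Bool using (Bool; true; false)
open import Data.Empty using (⊥-elim)
open import Data.Fin using (Fin; zero; suc; _<_; _<?_; _≟_; toℕ; _↑ˡ_; _↑ʳ_; splitAt; inject≤)
open import Data.Fin.Permutation
  using (Permutation′; _⟨$⟩ʳ_; _⟨$⟩ˡ_; _∘ₚ_; transpose; inverseˡ)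
  renaming (id to idₚ)
import Data.Fin.Permutation.Components as PC
open import Data.Fin.Properties
  using ( suc-injective; toℕ-↑ˡ; toℕ-↑ʳ; toℕ<n; splitAt-↑ˡ; splitAt-↑ʳ
        ; splitAt⁻¹-↑ˡ; splitAt⁻¹-↑ʳ; ↑ˡ-injective; ↑ʳ-injective
        ; ≤-antisym; <-asym; <⇒≢; injective⇒≤; inject≤-injective )
open import Data.Nat as ℕ using (ℕ; _≤_; _+_; _∸_)
open import Data.Nat.Properties
  using (≮⇒≥; m≤m+n; +-monoʳ-<; +-assoc; +-comm; m+n∸n≡m; ≤-reflexive; m≤n⇒∃[o]m+o≡n; ≤-trans)
open import Data.Product using (Σ; Σ-syntax; _×_; _,_; proj₁; proj₂)
open import Data.Sum using (_⊎_; inj₁; inj₂; [_,_]′)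
open import Function using (id; _∘_)
open import Function.Definitions using (Injective)
open import Relation.Binary.PropositionalEquality
  using (_≡_; _≢_; refl; trans; cong; cong₂; subst; module ≡-Reasoning)
  renaming (sym to ≡-sym)
open import Relation.Nullary using (yes; no)

private
  variable
    k m n : ℕ

transpose-matchˡ : (i j : Fin n) → PC.transpose i j i ≡ j
transpose-matchˡ i j with i ≟ i
... | yes _ = refl
... | no i≢i = ⊥-elim (i≢i refl)

transpose-fixes : (i j l : Fin n) → l ≢ i → l ≢ j → PC.transpose i j l ≡ l
transpose-fixes i j l l≢i l≢j with l ≟ i
... | yes l≡i = ⊥-elim (l≢i l≡i)
... | no _ with l ≟ j
...   | yes l≡j = ⊥-elim (l≢j l≡j)
...   | no _ = refl

permutation-sending : (f g : Fin m → Fin n) → Injective _≡_ _≡_ f → Injective _≡_ _≡_ g →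
  Σ[ σ ∈ Permutation′ n ] (∀ i → σ ⟨$⟩ʳ f i ≡ g i)
permutation-sending {ℕ.zero} f g _ _ = idₚ , λ ()
permutation-sending {ℕ.suc m} f g f-inj g-inj =
  σ ∘ₚ transpose x (g zero) , sends
  where
  rest = permutation-sending (f ∘ suc) (g ∘ suc)
           (suc-injective ∘ f-inj) (suc-injective ∘ g-inj)
  σ = proj₁ rest
  x = σ ⟨$⟩ʳ f zero

  sends : ∀ i → (σ ∘ₚ transpose x (g zero)) ⟨$⟩ʳ f i ≡ g i
  sends zero = transpose-matchˡ x (g zero)
  sends (suc i) = trans (cong (PC.transpose x (g zero)) (proj₂ rest i))
                        (transpose-fixes x (g zero) (g (suc i)) g≢x g≢g₀)
    where
    g≢x : g (suc i) ≢ x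
    g≢x g≡x with f-inj (begin
        f (suc i)                       ≡⟨ inverseˡ σ ⟨
        σ ⟨$⟩ˡ (σ ⟨$⟩ʳ f (suc i))       ≡⟨ cong (σ ⟨$⟩ˡ_) (trans (proj₂ rest i) g≡x) ⟩
        σ ⟨$⟩ˡ x                        ≡⟨ inverseˡ σ ⟩
        f zero                          ∎)
      where open ≡-Reasoning
    ... | ()
    g≢g₀ : g (suc i) ≢ g zero
    g≢g₀ g≡g₀ with g-inj g≡g₀
    ... | ()

letterGraph-if-< : (G : Graph n) {K : ℕ} (D : Fin K → Fin K → Bool) (w : Fin n → Fin K) →
  (∀ {i j} → i < j → adj G i j ≡ D (w i) (w j)) →
  ∀ i j → adj G i j ≡ letterGraph D w i j
letterGraph-if-< G D w agree i j with i <? j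
... | yes i<j = agree i<j
... | no i≮j with j <? i
...   | yes j<i = trans (sym G i j) (agree j<i)
...   | no j≮i with ≤-antisym (≮⇒≥ j≮i) (≮⇒≥ i≮j)
...     | refl = irrefl G i

inducedGraph : Graph n → (Fin m → Fin n) → Graph m
inducedGraph G f = record
  { adj = induced G f ; sym = λ i j → sym G (f i) (f j) ; irrefl = λ i → irrefl G (f i) }

relabel : Graph n → Permutation′ n → Graph n
relabel G σ = record
  { adj = λ p q → adj G (σ ⟨$⟩ˡ p) (σ ⟨$⟩ˡ q)
  ; sym = λ p q → sym G _ _
  ; irrefl = λ p → irrefl G _
  }

Iso-relabel : (G : Graph n) (σ : Permutation′ n) {B : Adj n} →
  (∀ p q → adj (relabel G σ) p q ≡ B p q) → Iso (adj G) B
Iso-relabel G σ relabel≡B = σ , λ u v →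
  trans (≡-sym (cong₂ (adj G) (inverseˡ σ) (inverseˡ σ))) (relabel≡B (σ ⟨$⟩ʳ u) (σ ⟨$⟩ʳ v))

Homogeneous : Graph n → (Fin m → Fin n) → Bool → Set
Homogeneous G f c = ∀ i j → i ≢ j → adj G (f i) (f j) ≡ c

homogeneous-colour : {G : Graph n} {f : Fin m → Fin n} →
  (∀ i j → i ≢ j → adj G (f i) (f j) ≡ true) ⊎ (∀ i j → adj G (f i) (f j) ≡ false) →
  Σ[ c ∈ Bool ] Homogeneous G f c
homogeneous-colour (inj₁ clique) = true , clique
homogeneous-colour (inj₂ independent) = false , λ i j _ → independent i j

homogeneous-at : {G : Graph n} {f : Fin m → Fin n} {c : Bool} → Homogeneous G f c →
  ∀ {i j p q} → f i ≡ p → f j ≡ q → p ≢ q → adj G p q ≡ c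
homogeneous-at hom {i} {j} refl refl p≢q = hom i j (p≢q ∘ cong _)

homogeneous-relabel : (G : Graph n) (σ : Permutation′ n) (f g : Fin m → Fin n) {c : Bool} →
  (∀ i → σ ⟨$⟩ʳ f i ≡ g i) → Homogeneous G f c → Homogeneous (relabel G σ) g c
homogeneous-relabel G σ f g σf≡g hom i j i≢j = begin
  adj G (σ ⟨$⟩ˡ g i) (σ ⟨$⟩ˡ g j)
    ≡⟨ cong₂ (λ p q → adj G (σ ⟨$⟩ˡ p) (σ ⟨$⟩ˡ q)) (σf≡g i) (σf≡g j) ⟨
  adj G (σ ⟨$⟩ˡ (σ ⟨$⟩ʳ f i)) (σ ⟨$⟩ˡ (σ ⟨$⟩ʳ f j))
    ≡⟨ cong₂ (adj G) (inverseˡ σ) (inverseˡ σ) ⟩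
  adj G (f i) (f j)
    ≡⟨ hom i j i≢j ⟩
  _ ∎
  where open ≡-Reasoning

homogeneous-letterGraph : (G : Graph n) (f : Fin m → Fin n) {c : Bool} → Homogeneous G f c →
  {K : ℕ} (w : Fin m → Fin K) → Iso (induced G f) (letterGraph (λ _ _ → c) w)
homogeneous-letterGraph G f hom w =
  idₚ , letterGraph-if-< (inducedGraph G f) _ w (λ i<j → hom _ _ (<⇒≢ i<j))

-- Positions in Fin (k + m + k) form a front block, a middle block and a back
-- block; the front and back blocks share the letters Fin k ⊆ Fin (k + m).
module Blocks (k m : ℕ) where

  front : Fin k → Fin (k + m + k)
  front a = (a ↑ˡ m) ↑ˡ k

  middle : Fin m → Fin (k + m + k)
  middle b = (k ↑ʳ b) ↑ˡ k

  back : Fin k → Fin (k + m + k)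
  back a = (k + m) ↑ʳ a

  ends : Fin (k + k) → Fin (k + m + k)
  ends i = [ front , back ]′ (splitAt k i)

  word : Fin (k + m + k) → Fin (k + m)
  word p = [ id , _↑ˡ m ]′ (splitAt (k + m) p)

  lastOccurrence : Fin (k + m) → Fin (k + m + k)
  lastOccurrence x = [ back , middle ]′ (splitAt k x)

  -- The first occurrence of the letter x is at position x ↑ˡ k.
  decoder : Graph (k + m + k) → Fin (k + m) → Fin (k + m) → Bool
  decoder G x y = adj G (x ↑ˡ k) (lastOccurrence y)

  data Block : Fin (k + m + k) → Set where
    in-front  : ∀ a → Block (front a)
    in-middle : ∀ b → Block (middle b)
    in-back   : ∀ a → Block (back a)

  block : ∀ p → Block p
  block p with splitAt (k + m) p in split-p
  ... | inj₂ a = subst Block (splitAt⁻¹-↑ʳ split-p) (in-back a)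
  ... | inj₁ x with splitAt k x in split-x
  ...   | inj₁ a = subst Block (trans (cong (_↑ˡ k) (splitAt⁻¹-↑ˡ split-x)) (splitAt⁻¹-↑ˡ split-p))
                         (in-front a)
  ...   | inj₂ b = subst Block (trans (cong (_↑ˡ k) (splitAt⁻¹-↑ʳ split-x)) (splitAt⁻¹-↑ˡ split-p))
                         (in-middle b)

  ends-front : ∀ a → ends (a ↑ˡ k) ≡ front a
  ends-front a rewrite splitAt-↑ˡ k a k = refl

  ends-back : ∀ a → ends (k ↑ʳ a) ≡ back a
  ends-back a rewrite splitAt-↑ʳ k k a = refl

  toℕ-front : ∀ a → toℕ (front a) ≡ toℕ a
  toℕ-front a = trans (toℕ-↑ˡ (a ↑ˡ m) k) (toℕ-↑ˡ a m)

  toℕ-middle : ∀ b → toℕ (middle b) ≡ k + toℕ b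
  toℕ-middle b = trans (toℕ-↑ˡ (k ↑ʳ b) k) (toℕ-↑ʳ k b)

  front<middle : ∀ a b → front a < middle b
  front<middle a b rewrite toℕ-front a | toℕ-middle b = ≤-trans (toℕ<n a) (m≤m+n k (toℕ b))

  front<back : ∀ a a′ → front a < back a′
  front<back a a′ rewrite toℕ-front a | toℕ-↑ʳ (k + m) a′ =
    ≤-trans (toℕ<n a) (≤-trans (m≤m+n k m) (m≤m+n (k + m) (toℕ a′)))

  middle<back : ∀ b a → middle b < back a
  middle<back b a rewrite toℕ-middle b | toℕ-↑ʳ (k + m) a =
    ≤-trans (+-monoʳ-< k (toℕ<n b)) (m≤m+n (k + m) (toℕ a))

  ends-injective : Injective _≡_ _≡_ ends
  ends-injective {i} {j} eq with splitAt k i in split-i | splitAt k j in split-j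
  ... | inj₁ a | inj₁ a′ with ↑ˡ-injective m a a′ (↑ˡ-injective k _ _ eq)
  ...   | refl = trans (≡-sym (splitAt⁻¹-↑ˡ split-i)) (splitAt⁻¹-↑ˡ split-j)
  ends-injective eq | inj₁ a | inj₂ a′ = ⊥-elim (<⇒≢ (front<back a a′) eq)
  ends-injective eq | inj₂ a | inj₁ a′ = ⊥-elim (<⇒≢ (front<back a′ a) (≡-sym eq))
  ends-injective eq | inj₂ a | inj₂ a′ with ↑ʳ-injective (k + m) a a′ eq
  ...   | refl = trans (≡-sym (splitAt⁻¹-↑ʳ split-i)) (splitAt⁻¹-↑ʳ split-j)

  word-front : ∀ a → word (front a) ≡ a ↑ˡ m
  word-front a rewrite splitAt-↑ˡ (k + m) (a ↑ˡ m) k = refl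

  word-middle : ∀ b → word (middle b) ≡ k ↑ʳ b
  word-middle b rewrite splitAt-↑ˡ (k + m) (k ↑ʳ b) k = refl

  word-back : ∀ a → word (back a) ≡ a ↑ˡ m
  word-back a rewrite splitAt-↑ʳ (k + m) k a = refl

  lastOccurrence-front : ∀ a → lastOccurrence (a ↑ˡ m) ≡ back a
  lastOccurrence-front a rewrite splitAt-↑ˡ k a m = refl

  lastOccurrence-middle : ∀ b → lastOccurrence (k ↑ʳ b) ≡ middle b
  lastOccurrence-middle b rewrite splitAt-↑ʳ k m b = refl

  module _ (G : Graph (k + m + k)) {c : Bool} (hom : Homogeneous G ends c) where

    ends-adj : ∀ {i j p q} → ends i ≡ p → ends j ≡ q → p ≢ q → adj G p q ≡ c
    ends-adj = homogeneous-at {G = G} {f = ends} hom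

    -- The decoder reads p < q at the first occurrence of word p and the last one of
    -- word q. These are p and q themselves unless both lie in the front block or
    -- both in the back block; there homogeneity makes the two readings agree.
    adj≡decoder : ∀ {p q} → p < q → adj G p q ≡ decoder G (word p) (word q)
    adj≡decoder {p} {q} p<q with block p | block q
    ... | in-front a | in-front a′
      rewrite word-front a | word-front a′ | lastOccurrence-front a′ =
        trans (ends-adj (ends-front a) (ends-front a′) (<⇒≢ p<q))
              (≡-sym (ends-adj (ends-front a) (ends-back a′) (<⇒≢ (front<back a a′))))
    ... | in-front a | in-middle b
      rewrite word-front a | word-middle b | lastOccurrence-middle b = refl
    ... | in-front a | in-back a′
      rewrite word-front a | word-back a′ | lastOccurrence-front a′ = refl
    ... | in-middle b | in-front a = ⊥-elim (<-asym p<q (front<middle a b))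
    ... | in-middle b | in-middle b′
      rewrite word-middle b | word-middle b′ | lastOccurrence-middle b′ = refl
    ... | in-middle b | in-back a
      rewrite word-middle b | word-back a | lastOccurrence-front a = refl
    ... | in-back a | in-front a′ = ⊥-elim (<-asym p<q (front<back a′ a))
    ... | in-back a | in-middle b = ⊥-elim (<-asym p<q (middle<back b a))
    ... | in-back a | in-back a′
      rewrite word-back a | word-back a′ | lastOccurrence-front a′ =
        trans (ends-adj (ends-back a) (ends-back a′) (<⇒≢ p<q))
              (≡-sym (ends-adj (ends-front a) (ends-back a′) (<⇒≢ (front<back a a′))))

    adj≡letterGraph : ∀ p q → adj G p q ≡ letterGraph (decoder G) word p q
    adj≡letterGraph = letterGraph-if-< G (decoder G) word adj≡decoder

homogeneous⇒IsLetterGraph : (k m : ℕ) (G : Graph (k + m + k)) (f : Fin (k + k) → Fin (k + m + k))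
  {c : Bool} → Injective _≡_ _≡_ f → Homogeneous G f c → IsLetterGraph G (k + m)
homogeneous⇒IsLetterGraph k m G f f-inj hom =
  word , decoder G′ ,
  Iso-relabel G σ (adj≡letterGraph G′ (homogeneous-relabel G σ f ends σf≡ends hom))
  where
  open Blocks k m
  moveToEnds = permutation-sending f ends f-inj ends-injective
  σ = proj₁ moveToEnds
  σf≡ends = proj₂ moveToEnds
  G′ = relabel G σ

lettericity-of-split : (k m : ℕ) (G : Graph n) → n ≡ k + m + k → (f : Fin (k + k) → Fin n)
  {c : Bool} → Injective _≡_ _≡_ f → Homogeneous G f c → LettericityAtMost G (n ∸ k)
lettericity-of-split k m G refl f f-inj hom =
  k + m , ≤-reflexive (≡-sym (m+n∸n≡m (k + m) k)) , homogeneous⇒IsLetterGraph k m G f f-inj hom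

homogeneous⇒lettericity : (k : ℕ) (G : Graph n) (f : Fin (k + k) → Fin n) {c : Bool} →
  Injective _≡_ _≡_ f → Homogeneous G f c → LettericityAtMost G (n ∸ k)
homogeneous⇒lettericity {n} k G f f-inj hom with m≤n⇒∃[o]m+o≡n (injective⇒≤ f-inj)
... | m , 2k+m≡n = lettericity-of-split k m G n≡k+m+k f f-inj hom
  where
  open ≡-Reasoning
  n≡k+m+k : n ≡ k + m + k
  n≡k+m+k = begin
    n             ≡⟨ 2k+m≡n ⟨
    k + k + m     ≡⟨ +-assoc k k m ⟩
    k + (k + m)   ≡⟨ cong (k +_) (+-comm k m) ⟩
    k + (m + k)   ≡⟨ +-assoc k m k ⟨
    k + m + k     ∎

RamseyProp-mono : {R : ℕ} → R ≤ n → RamseyProp m R → RamseyProp m n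
RamseyProp-mono R≤n ramsey G with ramsey (inducedGraph G (λ u → inject≤ u R≤n))
... | f , f-inj , homogeneous =
  (λ i → inject≤ (f i) R≤n) , f-inj ∘ inject≤-injective R≤n R≤n _ _ , homogeneous

proposition2 : (k : ℕ) → 1 ≤ k → (R : ℕ) → IsRamseyNumber (k + k) R →
    (n : ℕ) → R ≤ n → (G : Graph n) →
    (Σ (Fin (k + k) → Fin n) λ f → Injective _≡_ _≡_ f ×
       ((π : Permutation′ k) → Σ (Fin k → Fin k → Bool) λ D →
          Iso (induced G f) (letterGraph D (permWord π))))
    × LettericityAtMost G (n ∸ k)
proposition2 k _ R (ramsey , _) n R≤n G with RamseyProp-mono R≤n ramsey G
... | f , f-inj , clique-or-independent
  with homogeneous-colour {G = G} {f = f} clique-or-independent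
... | c , hom =
  (f , f-inj , λ π → (λ _ _ → c) , homogeneous-letterGraph G f hom (permWord π)) ,
  homogeneous⇒lettericity k G f f-inj hom
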